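{- Let $p,q\ge0$ be integers with $p+q\ge1$. Let $\gamma$ be an irreducible permutation in $\mathrm{Av}(123,\beta_{pq})$ and let $\delta$ be an expansible subset of $\gamma$. Then $|\delta|\le 2(p+q)+2$ if $p>0$ and $q>0$, and $|\delta|\le 2(p+q)+1$ if $p=0$ or $q=0$.
   Context: $\beta_{pq}=\lambda\,(q+1)\,(q+2)\,\mu$ of length $p+q+2$, where $\lambda=(p+q+2)(p+q+1)\cdots(q+3)$ (length $p$) and $\mu=q(q-1)\cdots1$ (length $q$). $\mathrm{Av}(123,\beta_{pq})$ is the set of permutations avoiding $123$ and $\beta_{pq}$. A permutation is irreducible if it has no two adjacent entries of the form $i+1,\,i$. A subset $E$ of the terms of an irreducible permutation $\theta$ in a class $X$ is expansible if for every $N$, simultaneously replacing each term of $E$ by a decreasing segment of $N$ consecutive values (and relabelling) yields a permutation in $X$; here $X=\mathrm{Av}(123,\beta_{pq})$. -}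

module Defs where

open import Data.Nat using (ℕ; zero; suc; _+_; _∸_; _<_; _≤_)
open import Data.Bool using (Bool; true; false; if_then_else_)
open import Data.Fin using (Fin; cast)
open import Data.Fin.Subset using (Subset)
open import Data.List using (List; []; _∷_; _++_; map; upTo; downFrom; length; lookup; concat; allFin)
open import Data.Nat.ListAction using (sum)
open import Data.List.Relation.Binary.Sublist.Propositional using (_⊆_)
open import Data.List.Relation.Binary.Permutation.Propositional using (_↭_)
open import Data.Product using (Σ; ∃; _×_)
open import Data.Vec using () renaming (lookup to vlookup)
open import Relation.Nullary using (¬_; does)
open import Relation.Binary.PropositionalEquality using (_≡_; _≢_)
open import Function.Bundles using (_⇔_)
open import Data.Nat using (_<?_)

Perm : Set
Perm = List ℕ

oneTo : ℕ → List ℕ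
oneTo n = map suc (upTo n)

IsPerm : Perm → Set
IsPerm σ = σ ↭ oneTo (length σ)

OrderIso : List ℕ → List ℕ → Set
OrderIso xs ys = Σ (length xs ≡ length ys) λ eq →
  ∀ (i j : Fin (length xs)) →
    (lookup xs i < lookup xs j) ⇔ (lookup ys (cast eq i) < lookup ys (cast eq j))

Contains : Perm → Perm → Set
Contains σ π = ∃ λ τ → (τ ⊆ σ) × OrderIso τ π

Avoids : Perm → Perm → Set
Avoids σ π = ¬ Contains σ π

-- β_{pq} = λ (q+1) (q+2) μ, with λ = (p+q+2)(p+q+1)...(q+3), μ = q(q-1)...1
β : ℕ → ℕ → Perm
β p q = map (λ k → k + q + 3) (downFrom p) ++ (suc q ∷ suc (suc q) ∷ map suc (downFrom q))

p123 : Perm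
p123 = 1 ∷ 2 ∷ 3 ∷ []

InAv : ℕ → ℕ → Perm → Set
InAv p q σ = IsPerm σ × Avoids σ p123 × Avoids σ (β p q)

Irreducible : Perm → Set
Irreducible σ = ∀ (xs ys : List ℕ) (a b : ℕ) → σ ≡ xs ++ (a ∷ b ∷ ys) → a ≢ suc b

-- Expansion of θ: each term θ(i) with i ∈ E replaced by a decreasing
-- segment of N consecutive values, all others kept as single terms, then
-- relabelled so that the result is a permutation of 1..(total length).
module _ (θ : Perm) (E : Subset (length θ)) (N : ℕ) where
  mult : Fin (length θ) → ℕ
  mult i = if vlookup E i then N else 1

  -- number of entries of the expansion with values below the block of i
  below : Fin (length θ) → ℕ
  below i = sum (map (λ j → if does (lookup θ j <? lookup θ i) then mult j else 0) (allFin (length θ)))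

  block : Fin (length θ) → List ℕ
  block i = map (λ k → below i + (mult i ∸ k)) (upTo (mult i))

  expand : Perm
  expand = concat (map block (allFin (length θ)))

Expansible : ℕ → ℕ → (θ : Perm) → Subset (length θ) → Set
Expansible p q θ E = ∀ (N : ℕ) → 1 ≤ N → InAv p q (expand θ E N)

{-# OPTIONS --safe #-}
-- Every entry of a 123-avoiding permutation γ is a left-to-right minimum or exceeds every later
-- entry, so δ splits into two kinds. Between two entries P < Q of δ of the same kind, classify the
-- entries j of that kind by their successor. A minimum is followed by an ascent or, γ being
-- irreducible, by a descent past γ(j) − 1, which then sits further right at a non-minimum; a
-- non-minimum is followed by a minimum or by a non-minimum, and then γ(j) − 1 sits further left at
-- a minimum. Too many entries of one class (p + 1 in one class of each kind, q + 1 in the other)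
-- spell out λ, (q+1)(q+2) and μ of β_{pq}, with the block replacing P or Q in an expansion of γ
-- standing in for λ or μ. Hence [P, Q) holds at most p + q entries of δ of that kind, and δ at
-- most p + q + 1 of each kind. When p = 0 (or q = 0), a minimum left of and below P (or Q) forms
-- (q+1)(q+2) together with P (or Q), which saves one non-minimum.
module Submission where

open import Defs
open import Algebra.Properties.CommutativeSemigroup using (x∙yz≈y∙xz)
open import Data.Bool using (Bool; true; false; if_then_else_)
open import Data.Empty using (⊥; ⊥-elim)
open import Data.Fin using (Fin; zero; suc; toℕ; fromℕ<; cast)
open import Data.Fin.Properties using (toℕ-fromℕ<; toℕ<n; fromℕ<-injective)
open import Data.Fin.Subset using (Subset; ∣_∣)
open import Data.List
  using (List; []; _∷_; _++_; length; map; concat; filter; take; drop; upTo; downFrom; applyUpTo;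
         tabulate; lookup)
open import Data.List.Membership.Propositional using (_∈_)
open import Data.List.Membership.Propositional.Properties
  using (∈-map⁺; ∈-map⁻; ∈-upTo⁺; ∈-upTo⁻; ∈-allFin; ∈-lookup)
open import Data.List.Properties
  using (map-upTo; map-applyUpTo; map-∘; map-cong; map-id; map-tabulate; concat-++;
         length-++; length-map; length-take; length-upTo; length-downFrom)
open import Data.List.Relation.Binary.Permutation.Propositional using (↭-sym; ↭⇒↭ₛ)
open import Data.List.Relation.Binary.Permutation.Propositional.Properties using (Any-resp-↭)
open import Data.List.Relation.Binary.Pointwise as Pointwise using (Pointwise; []; _∷_)
open import Data.List.Relation.Binary.Sublist.Heterogeneous using (Sublist; minimum; fromAny)
import Data.List.Relation.Binary.Sublist.Heterogeneous.Properties as Sublist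
open import Data.List.Relation.Binary.Sublist.Propositional using (_⊆_; []; _∷_; _∷ʳ_; ⊆-refl)
open import Data.List.Relation.Binary.Sublist.Propositional.Properties using (++⁺; ++⁺ˡ)
open import Data.List.Relation.Unary.All as All using (All; []; _∷_)
import Data.List.Relation.Unary.All.Properties as All
open import Data.List.Relation.Unary.AllPairs as AllPairs using (AllPairs; []; _∷_)
import Data.List.Relation.Unary.AllPairs.Properties as AllPairs
open import Data.List.Relation.Unary.Any as Any using (here; there)
open import Data.List.Relation.Unary.Any.Properties using (lookup-index)
open import Data.List.Relation.Unary.Unique.Propositional using (Unique)
import Data.List.Relation.Unary.Unique.Propositional.Properties as Unique
open import Data.Nat
open import Data.Nat.Induction using (<-rec)
open import Data.Nat.ListAction using (sum)
open import Data.Nat.Properties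
open import Data.Nat.Tactic.RingSolver using (solve-∀)
open import Data.Product using (_×_; ∃; ∃₂; _,_; proj₁; proj₂)
open import Data.Sum using (_⊎_; inj₁; inj₂)
open import Data.Vec using ([]; _∷_)
import Data.Vec as Vec
open import Function using (_∘_; id; _⇔_; mk⇔)
open import Relation.Binary using (tri<; tri≈; tri>)
open import Relation.Binary.PropositionalEquality
  using (_≡_; _≢_; refl; sym; trans; cong; cong₂; subst; subst₂; setoid; module ≡-Reasoning)
open import Data.List.Relation.Binary.Permutation.Setoid.Properties (setoid ℕ) using (Unique-resp-↭)
open import Relation.Nullary using (¬_; Dec; yes; no; does; contradiction; ¬?; _×-dec_)
open import Relation.Nullary.Decidable using (decidable-stable)
open import Relation.Unary using (Decidable)
open import Relation.Unary.Properties using (∁?)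

private
  variable
    A B : Set

-- Lists and finite families

AllPairs-map : ∀ {P : A → Set} {R : A → A → Set} {S : B → B → Set} {xs} (f : A → B) →
               (∀ {x y} → P x → P y → R x y → S (f x) (f y)) →
               All P xs → AllPairs R xs → AllPairs S (map f xs)
AllPairs-map f h [] [] = []
AllPairs-map f h (px ∷ pxs) (Rx ∷ Rxs) =
  All.map⁺ (All.zipWith (λ (py , r) → h px py r) (pxs , Rx)) ∷ AllPairs-map f h pxs Rxs

All-filter : ∀ {P Q : A → Set} (Q? : Decidable Q) {xs} → All P xs → All (λ x → P x × Q x) (filter Q? xs)
All-filter Q? {xs} Pxs = All.zip (All.filter⁺ Q? Pxs , All.all-filter Q? xs)

length-filter-∁ : ∀ {P : A → Set} (P? : Decidable P) xs →
                  length (filter P? xs) + length (filter (∁? P?) xs) ≡ length xs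
length-filter-∁ P? [] = refl
length-filter-∁ P? (x ∷ xs) with P? x
... | yes _ = cong suc (length-filter-∁ P? xs)
... | no _ = trans (+-suc _ _) (cong suc (length-filter-∁ P? xs))

take-exactly : ∀ k {P : A → Set} {R : A → A → Set} {xs} → k ≤ length xs → AllPairs R xs → All P xs →
               ∃ λ ys → length ys ≡ k × AllPairs R ys × All P ys
take-exactly k {xs = xs} k≤ xs↑ Pxs =
  take k xs , trans (length-take k xs) (m≤n⇒m⊓n≡m k≤) , AllPairs.take⁺ k xs↑ , All.take⁺ k Pxs

take-and-next : ∀ k {P : A → Set} {R : A → A → Set} {xs} → k < length xs → AllPairs R xs → All P xs →
                ∃₂ λ ys z → length ys ≡ k × AllPairs R ys × All (λ y → P y × R y z) ys × P z
take-and-next zero {xs = x ∷ _} _ _ (px ∷ _) = [] , x , refl , [] , [] , px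
take-and-next (suc k) {P} {R} {x ∷ xs} (s≤s k<) (Rx ∷ Rxs) (px ∷ pxs)
  with take-and-next k {λ y → P y × R x y} k< Rxs (All.zip (pxs , Rx))
... | ys , z , length-ys , ys↑ , before , (pz , Rxz) =
  x ∷ ys , z , cong suc length-ys , All.map (proj₂ ∘ proj₁) before ∷ ys↑ ,
  (px , Rxz) ∷ All.map (λ ((py , _) , Ryz) → py , Ryz) before , pz

no-k⇒length< : ∀ k {P : A → Set} {R : A → A → Set} {xs} → AllPairs R xs → All P xs →
               (∀ {ys} → AllPairs R ys → All P ys → length ys ≡ k → ⊥) →
               length xs < k
no-k⇒length< k xs↑ Pxs none = ≰⇒> λ k≤ →
  let ys , length-ys , ys↑ , Pys = take-exactly k k≤ xs↑ Pxs in none ys↑ Pys length-ys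

no-one-then-k⇒length≤ : ∀ k {P : A → Set} {R : A → A → Set} {xs} → AllPairs R xs → All P xs →
                        (∀ {x ys} → P x → AllPairs R ys → All (λ y → P y × R x y) ys →
                          length ys ≡ k → ⊥) →
                        length xs ≤ k
no-one-then-k⇒length≤ k [] [] none = z≤n
no-one-then-k⇒length≤ k (Rx ∷ xs↑) (Px ∷ Pxs) none = no-k⇒length< k xs↑ (All.zip (Pxs , Rx)) (none Px)

no-k-then-one⇒length≤ : ∀ k {P : A → Set} {R : A → A → Set} {xs} → AllPairs R xs → All P xs →
                        (∀ {ys z} → AllPairs R ys → All (λ y → P y × R y z) ys →
                          length ys ≡ k → P z → ⊥) →
                        length xs ≤ k
no-k-then-one⇒length≤ k xs↑ Pxs none = ≮⇒≥ λ k<length →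
  let ys , z , length-ys , ys↑ , before , Pz = take-and-next k k<length xs↑ Pxs
  in none ys↑ before length-ys Pz

window-bound : ∀ K {S : ℕ → Set} {xs} →
               (∀ {P Q zs} → S P → S Q → AllPairs _<_ zs → All (λ j → P ≤ j × j < Q × S j) zs →
                 length zs ≤ K) →
               AllPairs _<_ xs → All S xs → length xs ≤ suc K
window-bound K {S} bound xs↑ Sxs = no-k-then-one⇒length≤ (suc K) xs↑ Sxs refute
  where
  refute : ∀ {zs Q} → AllPairs _<_ zs → All (λ z → S z × z < Q) zs → length zs ≡ suc K → S Q → ⊥
  refute {P ∷ zs} (P<zs ∷ zs↑) ((SP , P<Q) ∷ zs-ok) length-zs SQ =
    1+n≰n (subst (_≤ K) length-zs (bound SP SQ (P<zs ∷ zs↑)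
      ((≤-refl , P<Q , SP) ∷ All.zipWith (λ (P<z , (Sz , z<Q)) → <⇒≤ P<z , z<Q , Sz) (P<zs , zs-ok))))

map-+-upTo-suc : ∀ lo m → map (lo +_) (upTo (suc m)) ≡ lo ∷ map (suc lo +_) (upTo m)
map-+-upTo-suc lo m = cong₂ _∷_ (+-identityʳ lo) (begin
  map (lo +_) (applyUpTo suc m)   ≡⟨ cong (map (lo +_)) (map-upTo suc m) ⟨
  map (lo +_) (map suc (upTo m))  ≡⟨ map-∘ (upTo m) ⟨
  map (λ i → lo + suc i) (upTo m) ≡⟨ map-cong (+-suc lo) (upTo m) ⟩
  map (suc lo +_) (upTo m)        ∎)
  where open ≡-Reasoning

sorted⊆range : ∀ m {lo ks} → AllPairs _<_ ks → All (λ k → lo ≤ k × k < lo + m) ks →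
               ks ⊆ map (lo +_) (upTo m)
sorted⊆range zero {ks = []} _ _ = []
sorted⊆range zero {lo} {k ∷ _} _ ((lo≤k , k<lo+0) ∷ _) =
  ⊥-elim (<⇒≱ (subst (k <_) (+-identityʳ lo) k<lo+0) lo≤k)
sorted⊆range (suc m) {lo} sorted bounds rewrite map-+-upTo-suc lo m = go sorted bounds
  where
  shift : ∀ {ks} → All (λ k → lo < k × k < lo + suc m) ks → All (λ k → suc lo ≤ k × k < suc lo + m) ks
  shift = All.map (λ {k} (lo<k , k<) → lo<k , subst (k <_) (+-suc lo m) k<)
  go : ∀ {ks} → AllPairs _<_ ks → All (λ k → lo ≤ k × k < lo + suc m) ks →
       ks ⊆ lo ∷ map (suc lo +_) (upTo m)
  go [] [] = minimum _
  go {k ∷ _} (k<ks ∷ ks↑) ((lo≤k , k<) ∷ bounds) with lo ≟ k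
  ... | yes refl = refl ∷ sorted⊆range m ks↑
        (shift (All.zipWith (λ (k<j , (_ , j<)) → k<j , j<) (k<ks , bounds)))
  ... | no lo≢k = lo ∷ʳ sorted⊆range m (k<ks ∷ ks↑)
        (shift ((≤∧≢⇒< lo≤k lo≢k , k<) ∷
                All.zipWith (λ (k<j , (_ , j<)) → ≤-<-trans lo≤k k<j , j<) (k<ks , bounds)))

sorted⊆upTo : ∀ {n ks} → AllPairs _<_ ks → All (_< n) ks → ks ⊆ upTo n
sorted⊆upTo {n} ks↑ ks<n = subst (_ ⊆_) (map-id (upTo n)) (sorted⊆range n ks↑ (All.map (z≤n ,_) ks<n))

concat-⊆ : ∀ {f : A → List B} {xss ks} → Sublist (λ xs k → xs ⊆ f k) xss ks →
           concat xss ⊆ concat (map f ks)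
concat-⊆ [] = []
concat-⊆ {f = f} (k ∷ʳ xss⊆) = ++⁺ˡ (f k) (concat-⊆ xss⊆)
concat-⊆ (xs⊆ ∷ xss⊆) = ++⁺ xs⊆ (concat-⊆ xss⊆)

length-concat-take : ∀ c (f : A → List B) {ks} → All (λ k → c ≤ length (f k)) ks →
                     length (concat (map (λ k → take c (f k)) ks)) ≡ c * length ks
length-concat-take c f [] = sym (*-zeroʳ c)
length-concat-take c f {k ∷ ks} (c≤ ∷ c≤s) = begin
  length (take c (f k) ++ _) ≡⟨ length-++ (take c (f k)) ⟩
  length (take c (f k)) + _  ≡⟨ cong₂ _+_ (trans (length-take c (f k)) (m≤n⇒m⊓n≡m c≤))
                                           (length-concat-take c f c≤s) ⟩
  c + c * length ks          ≡⟨ *-suc c (length ks) ⟨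
  c * suc (length ks)        ∎
  where open ≡-Reasoning

sum-map-mono : ∀ {f h : A → ℕ} → (∀ y → f y ≤ h y) → ∀ xs → sum (map f xs) ≤ sum (map h xs)
sum-map-mono f≤h [] = z≤n
sum-map-mono f≤h (x ∷ xs) = +-mono-≤ (f≤h x) (sum-map-mono f≤h xs)

sum-map-+-≤ : ∀ {f h : A → ℕ} {x xs} e → (∀ y → f y ≤ h y) → x ∈ xs → e + f x ≤ h x →
              e + sum (map f xs) ≤ sum (map h xs)
sum-map-+-≤ {f = f} {h} {x} {_ ∷ xs} e f≤h (here refl) gap =
  subst (_≤ h x + sum (map h xs)) (+-assoc e (f x) _) (+-mono-≤ gap (sum-map-mono f≤h xs))
sum-map-+-≤ {f = f} {h} {xs = y ∷ xs} e f≤h (there x∈xs) gap =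
  subst (_≤ h y + sum (map h xs)) (x∙yz≈y∙xz +-commutativeSemigroup (f y) e _)
        (+-mono-≤ (f≤h y) (sum-map-+-≤ e f≤h x∈xs gap))

least : ∀ {P : ℕ → Set} → Decidable P → ∀ {k} → P k →
        ∃ λ m → m ≤ k × P m × (∀ {j} → j < m → ¬ P j)
least {P} P? {k} = <-rec Least step k
  where
  Least : ℕ → Set
  Least k = P k → ∃ λ m → m ≤ k × P m × (∀ {j} → j < m → ¬ P j)
  step : ∀ k → (∀ {j} → j < k → Least j) → Least k
  step k rec Pk with anyUpTo? P? k
  ... | no none = k , ≤-refl , Pk , λ j<k Pj → none (_ , j<k , Pj)
  ... | yes (j , j<k , Pj) with rec j<k Pj
  ...   | m , m≤j , Pm , minimal = m , ≤-trans m≤j (<⇒≤ j<k) , Pm , minimal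

extend : ∀ {n} → A → (Fin n → A) → ℕ → A
extend {n = zero} d f _ = d
extend {n = suc n} d f zero = f zero
extend {n = suc n} d f (suc k) = extend d (f ∘ suc) k

extend-toℕ : ∀ {n} (d : A) (f : Fin n → A) i → extend d f (toℕ i) ≡ f i
extend-toℕ d f zero = refl
extend-toℕ d f (suc i) = extend-toℕ d (f ∘ suc) i

extend-fromℕ< : ∀ {n k} (d : A) (f : Fin n → A) (k<n : k < n) → extend d f k ≡ f (fromℕ< k<n)
extend-fromℕ< d f k<n = trans (cong (extend d f) (sym (toℕ-fromℕ< k<n))) (extend-toℕ d f (fromℕ< k<n))

map-extend-upTo : ∀ {n} (d : A) (f : Fin n → A) → map (extend d f) (upTo n) ≡ tabulate f
map-extend-upTo {n = zero} d f = refl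
map-extend-upTo {n = suc n} d f = cong (f zero ∷_) (begin
  map (extend d f) (applyUpTo suc n) ≡⟨ map-applyUpTo suc (extend d f) n ⟩
  applyUpTo (extend d (f ∘ suc)) n   ≡⟨ map-upTo (extend d (f ∘ suc)) n ⟨
  map (extend d (f ∘ suc)) (upTo n)  ≡⟨ map-extend-upTo d (f ∘ suc) ⟩
  tabulate (f ∘ suc)                 ∎)
  where open ≡-Reasoning

lookup-injective : ∀ {xs : List A} → Unique xs → ∀ {i j} → lookup xs i ≡ lookup xs j → i ≡ j
lookup-injective (_ ∷ _) {zero} {zero} _ = refl
lookup-injective (x∉xs ∷ _) {zero} {suc j} x≡ = contradiction x≡ (All.lookup x∉xs (∈-lookup j))
lookup-injective (x∉xs ∷ _) {suc i} {zero} ≡x = contradiction (sym ≡x) (All.lookup x∉xs (∈-lookup i))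
lookup-injective (_ ∷ xs!) {suc i} {suc j} eq = cong suc (lookup-injective xs! eq)

split-adjacent : ∀ {d : A} xs i → suc i < length xs →
                 xs ≡ take i xs ++ extend d (lookup xs) i ∷ extend d (lookup xs) (suc i) ∷ drop (suc (suc i)) xs
split-adjacent (_ ∷ _ ∷ _) zero _ = refl
split-adjacent (x ∷ xs) (suc i) (s≤s si<) = cong (x ∷_) (split-adjacent xs i si<)

members : ∀ {n} → Subset n → List ℕ
members [] = []
members (true ∷ p) = 0 ∷ map suc (members p)
members (false ∷ p) = map suc (members p)

length-members : ∀ {n} (p : Subset n) → length (members p) ≡ ∣ p ∣
length-members [] = refl
length-members (true ∷ p) = cong suc (trans (length-map suc (members p)) (length-members p))
length-members (false ∷ p) = trans (length-map suc (members p)) (length-members p)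

members-sorted : ∀ {n} (p : Subset n) → AllPairs _<_ (members p)
members-sorted [] = []
members-sorted (true ∷ p) =
  All.map⁺ (All.universal (λ _ → z<s) (members p)) ∷ AllPairs.map⁺ (AllPairs.map s<s (members-sorted p))
members-sorted (false ∷ p) = AllPairs.map⁺ (AllPairs.map s<s (members-sorted p))

members-inside : ∀ {n} (p : Subset n) → All (λ k → k < n × extend false (Vec.lookup p) k ≡ true) (members p)
members-inside [] = []
members-inside (true ∷ p) = (z<s , refl) ∷ All.map⁺ (All.map (λ (k<n , pk) → s<s k<n , pk) (members-inside p))
members-inside (false ∷ p) = All.map⁺ (All.map (λ (k<n , pk) → s<s k<n , pk) (members-inside p))

-- Order isomorphism

SameComparisons : ℕ → ℕ → ℕ → ℕ → Set
SameComparisons x x′ y y′ = (x < y ⇔ x′ < y′) × (y < x ⇔ y′ < x′)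

data SameOrder : List ℕ → List ℕ → Set where
  [] : SameOrder [] []
  _∷_ : ∀ {x x′ ys ys′} → Pointwise (SameComparisons x x′) ys ys′ → SameOrder ys ys′ →
        SameOrder (x ∷ ys) (x′ ∷ ys′)

SameOrder-length : ∀ {xs ys} → SameOrder xs ys → length xs ≡ length ys
SameOrder-length [] = refl
SameOrder-length (_ ∷ xs∼ys) = cong suc (SameOrder-length xs∼ys)

SameOrder-lookup : ∀ {xs ys} → SameOrder xs ys → .(eq : length xs ≡ length ys) → ∀ i j →
                   (lookup xs i < lookup xs j) ⇔ (lookup ys (cast eq i) < lookup ys (cast eq j))
SameOrder-lookup (_ ∷ _) _ zero zero = mk⇔ (⊥-elim ∘ <-irrefl refl) (⊥-elim ∘ <-irrefl refl)
SameOrder-lookup (x∼y ∷ _) _ zero (suc j) = proj₁ (Pointwise.lookup⁺ x∼y j)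
SameOrder-lookup (x∼y ∷ _) _ (suc i) zero = proj₂ (Pointwise.lookup⁺ x∼y i)
SameOrder-lookup (_ ∷ xs∼ys) eq (suc i) (suc j) = SameOrder-lookup xs∼ys (cong pred eq) i j

SameOrder⇒OrderIso : ∀ {xs ys} → SameOrder xs ys → OrderIso xs ys
SameOrder⇒OrderIso xs∼ys = SameOrder-length xs∼ys , SameOrder-lookup xs∼ys (SameOrder-length xs∼ys)

all-below : ∀ {x x′ ys ys′} → All (_< x) ys → All (_< x′) ys′ → length ys ≡ length ys′ →
            Pointwise (SameComparisons x x′) ys ys′
all-below [] [] _ = []
all-below (y<x ∷ ys<x) (y′<x′ ∷ ys′<x′) eq =
  (mk⇔ (λ x<y → ⊥-elim (<-asym x<y y<x)) (λ x′<y′ → ⊥-elim (<-asym x′<y′ y′<x′)) ,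
   mk⇔ (λ _ → y′<x′) (λ _ → y<x)) ∷
  all-below ys<x ys′<x′ (suc-injective eq)

all-above : ∀ {x x′ ys ys′} → All (x <_) ys → All (x′ <_) ys′ → length ys ≡ length ys′ →
            Pointwise (SameComparisons x x′) ys ys′
all-above [] [] _ = []
all-above (x<y ∷ x<ys) (x′<y′ ∷ x′<ys′) eq =
  (mk⇔ (λ _ → x′<y′) (λ _ → x<y) ,
   mk⇔ (λ y<x → ⊥-elim (<-asym x<y y<x)) (λ y′<x′ → ⊥-elim (<-asym x′<y′ y′<x′))) ∷
  all-above x<ys x′<ys′ (suc-injective eq)

ascending-SameOrder : ∀ {xs ys} → AllPairs _<_ xs → AllPairs _<_ ys → length xs ≡ length ys →
                      SameOrder xs ys
ascending-SameOrder [] [] _ = []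
ascending-SameOrder (x<xs ∷ xs↑) (y<ys ∷ ys↑) eq =
  all-above x<xs y<ys (suc-injective eq) ∷ ascending-SameOrder xs↑ ys↑ (suc-injective eq)

descending-SameOrder : ∀ {xs ys} → AllPairs _>_ xs → AllPairs _>_ ys → length xs ≡ length ys →
                       SameOrder xs ys
descending-SameOrder [] [] _ = []
descending-SameOrder (x>xs ∷ xs↓) (y>ys ∷ ys↓) eq =
  all-below x>xs y>ys (suc-injective eq) ∷ descending-SameOrder xs↓ ys↓ (suc-injective eq)

-- The shape of β_{pq} = λ (q+1) (q+2) μ, read as L a b R.
record βShaped (L : List ℕ) (a b : ℕ) (R : List ℕ) : Set where
  constructor βshaped
  field
    left-descending : AllPairs _>_ L
    b<left : All (b <_) L
    a<b : a < b
    right<a : All (_< a) R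
    right-descending : AllPairs _>_ R

βShaped-SameOrder : ∀ {L a b R L′ a′ b′ R′} → βShaped L a b R → βShaped L′ a′ b′ R′ →
                    length L ≡ length L′ → length R ≡ length R′ →
                    SameOrder (L ++ a ∷ b ∷ R) (L′ ++ a′ ∷ b′ ∷ R′)
βShaped-SameOrder {[]} {L′ = []} s s′ _ eqR =
  (a∼b ∷ all-below (right<a s) (right<a s′) eqR) ∷
  all-below (All.map (λ r<a → <-trans r<a (a<b s)) (right<a s))
            (All.map (λ r<a → <-trans r<a (a<b s′)) (right<a s′)) eqR ∷
  descending-SameOrder (right-descending s) (right-descending s′) eqR
  where
  open βShaped
  a∼b = mk⇔ (λ _ → a<b s′) (λ _ → a<b s) ,
        mk⇔ (λ b<a → ⊥-elim (<-asym b<a (a<b s))) (λ b<a → ⊥-elim (<-asym b<a (a<b s′)))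
βShaped-SameOrder {h ∷ L} {L′ = h′ ∷ L′} s s′ eqL eqR =
  all-below (below-head s) (below-head s′) (begin
    length (L ++ _)         ≡⟨ length-++ L ⟩
    length L + suc (suc _)  ≡⟨ cong₂ (λ l r → l + suc (suc r)) (suc-injective eqL) eqR ⟩
    length L′ + suc (suc _) ≡⟨ length-++ L′ ⟨
    length (L′ ++ _)        ∎) ∷
  βShaped-SameOrder (tail-shape s) (tail-shape s′) (suc-injective eqL) eqR
  where
  open ≡-Reasoning
  tail-shape : ∀ {h L a b R} → βShaped (h ∷ L) a b R → βShaped L a b R
  tail-shape (βshaped (_ ∷ L↓) (_ ∷ b<L) a<b R<a R↓) = βshaped L↓ b<L a<b R<a R↓
  below-head : ∀ {h L a b R} → βShaped (h ∷ L) a b R → All (_< h) (L ++ a ∷ b ∷ R)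
  below-head (βshaped (h>L ∷ _) (b<h ∷ _) a<b R<a _) =
    All.++⁺ h>L (a<h ∷ b<h ∷ All.map (λ r<a → <-trans r<a a<h) R<a)
    where a<h = <-trans a<b b<h

β-βShaped : ∀ p q → βShaped (map (λ k → k + q + 3) (downFrom p)) (suc q) (suc (suc q)) (map suc (downFrom q))
β-βShaped p q = βshaped
  (AllPairs.map⁺ (downFrom-descending (λ j<i → +-monoˡ-< 3 (+-monoˡ-< q j<i)) p))
  (All.map⁺ (All.universal (λ k → subst (_≤ k + q + 3) (+-comm q 3) (+-monoˡ-≤ 3 (m≤n+m q k)))
                           (downFrom p)))
  ≤-refl
  (All.map⁺ (All.applyDownFrom⁺₁ id q s<s))
  (AllPairs.map⁺ (downFrom-descending s<s q))
  where
  downFrom-descending : ∀ {R : ℕ → ℕ → Set} → (∀ {i j} → j < i → R i j) → ∀ m →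
                        AllPairs R (downFrom m)
  downFrom-descending R-ij m = AllPairs.applyDownFrom⁺₁ id m (λ j<i _ → R-ij j<i)

βShaped⇒OrderIso : ∀ {p q L a b R} → βShaped L a b R → length L ≡ p → length R ≡ q →
                   OrderIso (L ++ a ∷ b ∷ R) (β p q)
βShaped⇒OrderIso {p} {q} s refl refl = SameOrder⇒OrderIso (βShaped-SameOrder s (β-βShaped p q)
  (sym (trans (length-map _ (downFrom p)) (length-downFrom p)))
  (sym (trans (length-map _ (downFrom q)) (length-downFrom q))))

ascending⇒OrderIso-123 : ∀ {a b c} → a < b → b < c → OrderIso (a ∷ b ∷ c ∷ []) p123
ascending⇒OrderIso-123 a<b b<c = SameOrder⇒OrderIso (ascending-SameOrder
  ((a<b ∷ <-trans a<b b<c ∷ []) ∷ (b<c ∷ []) ∷ [] ∷ [])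
  ((≤-refl ∷ n≤1+n 2 ∷ []) ∷ (≤-refl ∷ []) ∷ [] ∷ []) refl)

-- Permutations avoiding 123

module Configurations (n : ℕ) (g : ℕ → ℕ) (Blown : ℕ → Set) (p q : ℕ) where

  Descending : List ℕ → Set
  Descending = AllPairs (λ a b → a < b × g b < g a)

  -- w decreasing terms of the pattern: w single entries of g, or w terms of the block that
  -- replaces one blown-up entry.
  data Side (w : ℕ) (Region : ℕ → Set) : Set where
    entries : (C : List ℕ) → Descending C → All Region C → length C ≡ w → Side w Region
    blown : (d : ℕ) → Blown d → Region d → Side w Region

  record βConfiguration : Set where
    field
      x y : ℕ
      x<y : x < y
      y<n : y < n
      gx<gy : g x < g y
      left : Side p (λ c → c < x × g y < g c)
      right : Side q (λ e → y < e × e < n × g e < g x)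

module Avoids123
  (n : ℕ) (g : ℕ → ℕ)
  (g-injective : ∀ {i j} → i < n → j < n → g i ≡ g j → i ≡ j)
  (no-123 : ∀ {i j k} → i < j → j < k → k < n → g i < g j → g j < g k → ⊥)
  where

  LRMin : ℕ → Set
  LRMin i = ∀ {j} → j < i → g i < g j

  lrmin? : Decidable LRMin
  lrmin? i = allUpTo? (λ j → g i <? g j) i

  LRMin-≤ : ∀ {i j} → LRMin i → j ≤ i → g i ≤ g j
  LRMin-≤ min j≤i with m≤n⇒m<n∨m≡n j≤i
  ... | inj₁ j<i = <⇒≤ (min j<i)
  ... | inj₂ refl = ≤-refl

  earlier-smaller : ∀ {i} → i < n → ¬ LRMin i → ∃ λ j → j < i × g j < g i
  earlier-smaller {i} i<n ¬min with anyUpTo? (λ j → g j <? g i) i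
  ... | yes found = found
  ... | no none = ⊥-elim (¬min λ {j} j<i →
        ≤∧≢⇒< (≮⇒≥ λ gj<gi → none (j , j<i , gj<gi))
              (λ gi≡gj → <-irrefl (g-injective (<-trans j<i i<n) i<n (sym gi≡gj)) j<i))

  later-smaller : ∀ {i k} → ¬ LRMin i → i < k → k < n → g k < g i
  later-smaller {i} {k} ¬min i<k k<n with earlier-smaller (<-trans i<k k<n) ¬min | <-cmp (g k) (g i)
  ... | _ | tri< gk<gi _ _ = gk<gi
  ... | _ | tri≈ _ gk≡gi _ = ⊥-elim (<-irrefl (g-injective (<-trans i<k k<n) k<n (sym gk≡gi)) i<k)
  ... | j , j<i , gj<gi | tri> _ _ gi<gk = ⊥-elim (no-123 j<i i<k k<n gj<gi gi<gk)

  later-≤ : ∀ {i k} → ¬ LRMin i → i ≤ k → k < n → g k ≤ g i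
  later-≤ ¬min i≤k k<n with m≤n⇒m<n∨m≡n i≤k
  ... | inj₁ i<k = <⇒≤ (later-smaller ¬min i<k k<n)
  ... | inj₂ refl = ≤-refl

  smaller-later : ∀ {i k} → LRMin i → g k < g i → i < k
  smaller-later {i} {k} min gk<gi with <-cmp i k
  ... | tri< i<k _ _ = i<k
  ... | tri≈ _ refl _ = ⊥-elim (<-irrefl refl gk<gi)
  ... | tri> _ _ k<i = ⊥-elim (<-asym gk<gi (min k<i))

  larger-earlier : ∀ {i k} → ¬ LRMin i → k < n → i < n → g i < g k → k < i
  larger-earlier {i} {k} ¬min k<n i<n gi<gk with <-cmp k i
  ... | tri< k<i _ _ = k<i
  ... | tri≈ _ refl _ = ⊥-elim (<-irrefl refl gi<gk)
  ... | tri> _ _ i<k = ⊥-elim (<-asym gi<gk (later-smaller ¬min i<k k<n))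

  LRMin-at-most : ∀ j → ∃ λ m → m ≤ j × LRMin m × g m ≤ g j
  LRMin-at-most j with least (λ m → g m ≤? g j) {j} ≤-refl
  ... | m , m≤j , gm≤gj , minimal = m , m≤j , (λ k<m → ≤-<-trans gm≤gj (≰⇒> (minimal k<m))) , gm≤gj

  earlier-LRMin : ∀ {i} → i < n → ¬ LRMin i → ∃ λ m → m < i × LRMin m × g m < g i
  earlier-LRMin i<n ¬min with earlier-smaller i<n ¬min
  ... | j , j<i , gj<gi with LRMin-at-most j
  ... | m , m≤j , min , gm≤gj = m , ≤-<-trans m≤j j<i , min , ≤-<-trans gm≤gj gj<gi

  first-¬LRMin-after : ∀ {i Q} → i < Q → ¬ LRMin Q →
                       ∃ λ r → i < r × r ≤ Q × ¬ LRMin r × (∀ {j} → i < j → j < r → LRMin j)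
  first-¬LRMin-after {i} i<Q ¬minQ with least (λ r → i <? r ×-dec ¬? (lrmin? r)) (i<Q , ¬minQ)
  ... | r , r≤Q , (i<r , ¬min-r) , minimal =
    r , i<r , r≤Q , ¬min-r , λ i<j j<r → decidable-stable (lrmin? _) (λ ¬min-j → minimal j<r (i<j , ¬min-j))

  Ascent : ℕ → Set
  Ascent i = g i < g (suc i)

  ascent? : Decidable Ascent
  ascent? i = g i <? g (suc i)

  ascent⇒¬LRMin : ∀ {i} → Ascent i → ¬ LRMin (suc i)
  ascent⇒¬LRMin asc min = <-asym asc (min ≤-refl)

  ¬ascent⇒descent : ∀ {i} → suc i < n → ¬ Ascent i → g (suc i) < g i
  ¬ascent⇒descent si<n ¬asc =
    ≤∧≢⇒< (≮⇒≥ ¬asc) (λ eq → <-irrefl (sym (g-injective si<n (<-trans ≤-refl si<n) eq)) ≤-refl)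

  module Irreducible
    (g-positive : ∀ {i} → i < n → 0 < g i)
    (g-≤ : ∀ {i} → i < n → g i ≤ n)
    (g-onto : ∀ {v} → 0 < v → v ≤ n → ∃ λ t → t < n × g t ≡ v)
    (irreducible : ∀ {i} → suc i < n → g i ≢ suc (g (suc i)))
    where

    -- The position of the value g i − 1; junk 0 when that value does not occur.
    predecessor : ℕ → ℕ
    predecessor i with anyUpTo? (λ t → suc (g t) ≟ g i) n
    ... | yes (t , _) = t
    ... | no _ = 0

    predecessor-spec : ∀ {i k} → i < n → k < n → g k < g i →
                       predecessor i < n × suc (g (predecessor i)) ≡ g i
    predecessor-spec {i} {k} i<n k<n gk<gi with anyUpTo? (λ t → suc (g t) ≟ g i) n
    ... | yes (_ , t<n , eq) = t<n , eq
    ... | no none with g-onto {pred (g i)} (≤-trans (g-positive k<n) (pred-mono-≤ gk<gi))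
                                            (≤-trans pred[n]≤n (g-≤ i<n))
    ...   | t , t<n , gt≡ = ⊥-elim (none (t , t<n ,
            trans (cong suc gt≡) (suc-pred (g i) {{>-nonZero (≤-<-trans z≤n gk<gi)}})))

    predecessor-mono : ∀ {a b s t} → suc (g s) ≡ g a → suc (g t) ≡ g b → g b < g a → g t < g s
    predecessor-mono gs≡ga gt≡gb gb<ga = s<s⁻¹ (subst₂ _<_ (sym gt≡gb) (sym gs≡ga) gb<ga)

    below-predecessor : ∀ {i t k} → suc (g t) ≡ g i → g k < g i → g k ≤ g t
    below-predecessor {k = k} gt≡gi gk<gi = s≤s⁻¹ (subst (g k <_) (sym gt≡gi) gk<gi)

    descent-below-predecessor : ∀ {i t} → suc i < n → g (suc i) < g i → suc (g t) ≡ g i → g (suc i) < g t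
    descent-below-predecessor si<n desc gt≡gi = ≤∧≢⇒< (below-predecessor gt≡gi desc)
      (λ gsi≡gt → irreducible si<n (trans (sym gt≡gi) (cong suc (sym gsi≡gt))))

    record Gap (i : ℕ) : Set where
      field
        t<n : predecessor i < n
        g-t : suc (g (predecessor i)) ≡ g i
        gap : g (suc i) < g (predecessor i)

    descent-Gap : ∀ {i} → suc i < n → g (suc i) < g i → Gap i
    descent-Gap si<n desc = record { t<n = proj₁ spec ; g-t = proj₂ spec
                                   ; gap = descent-below-predecessor si<n desc (proj₂ spec) }
      where spec = predecessor-spec (<-trans ≤-refl si<n) si<n desc

    LRMin-Gap : ∀ {i} → LRMin i → (G : Gap i) → suc i < predecessor i × ¬ LRMin (predecessor i)
    LRMin-Gap min G = si<t , λ min-t → <⇒≱ gap (LRMin-≤ min-t (<⇒≤ si<t))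
      where
      open Gap G
      si<t = ≤∧≢⇒< (smaller-later min (≤-reflexive g-t)) (λ si≡t → <-irrefl (cong g si≡t) gap)

    ¬LRMin-Gap : ∀ {i} → ¬ LRMin (suc i) → i < n → (G : Gap i) → predecessor i < i × LRMin (predecessor i)
    ¬LRMin-Gap {i} ¬min-si i<n G =
      ≤∧≢⇒< (≮⇒≥ not-after) (λ t≡i → <-irrefl (cong g t≡i) (≤-reflexive g-t)) ,
      decidable-stable (lrmin? _) (λ ¬min-t → not-after (larger-earlier ¬min-t i<n t<n (≤-reflexive g-t)))
      where
      open Gap G
      not-after : ¬ i < predecessor i
      not-after i<t with m≤n⇒m<n∨m≡n i<t
      ... | inj₁ si<t = <-asym gap (later-smaller ¬min-si si<t t<n)
      ... | inj₂ si≡t = <-irrefl (cong g si≡t) gap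

    module Bounds (Blown : ℕ → Set) (p q : ℕ) (no-β : ¬ Configurations.βConfiguration n g Blown p q) where
      open Configurations n g Blown p q

      suc-LRMin-Descending : ∀ {Rs} → AllPairs _<_ Rs → All (LRMin ∘ suc) Rs → Descending (map suc Rs)
      suc-LRMin-Descending Rs↑ mins = AllPairs-map suc (λ _ min-b a<b → s<s a<b , min-b (s<s a<b)) mins Rs↑

      ascent-≢ : ∀ {c k} → Ascent c → LRMin k → suc c ≢ k
      ascent-≢ asc min refl = ascent⇒¬LRMin asc min

      min-ascents-configuration : ∀ {Q i Cs} → Blown Q → LRMin Q → Q < n → i < Q → LRMin i → Ascent i →
                                  AllPairs _<_ Cs → All (λ c → Ascent c × c < i) Cs → length Cs ≡ p →
                                  βConfiguration
      min-ascents-configuration {Q} {i} {Cs} BQ minQ Q<n i<Q min-i asc-i Cs↑ Cs-ok length-Cs = record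
        { x = i ; y = suc i ; x<y = ≤-refl ; y<n = si<n ; gx<gy = asc-i
        ; left = entries (map suc Cs) (AllPairs-map suc descending Cs-ok Cs↑) (All.map⁺ (All.map region Cs-ok))
                         (trans (length-map suc Cs) length-Cs)
        ; right = blown Q BQ (≤∧≢⇒< i<Q (ascent-≢ asc-i minQ) , Q<n , minQ i<Q) }
        where
        si<n = ≤-<-trans i<Q Q<n
        descending : ∀ {a b} → Ascent a × a < i → Ascent b × b < i → a < b →
                     suc a < suc b × g (suc b) < g (suc a)
        descending (asc-a , _) (_ , b<i) a<b =
          s<s a<b , later-smaller (ascent⇒¬LRMin asc-a) (s<s a<b) (<-trans (s<s b<i) si<n)
        region : ∀ {c} → Ascent c × c < i → suc c < i × g (suc i) < g (suc c)
        region (asc-c , c<i) =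
          ≤∧≢⇒< c<i (ascent-≢ asc-c min-i) , later-smaller (ascent⇒¬LRMin asc-c) (s<s c<i) si<n

      min-ascents≤p : ∀ {Q As} → Blown Q → LRMin Q → Q < n → AllPairs _<_ As →
                      All (λ j → j < Q × LRMin j × Ascent j) As → length As ≤ p
      min-ascents≤p BQ minQ Q<n As↑ As-ok = no-k-then-one⇒length≤ p As↑ As-ok
        λ Cs↑ Cs-ok length-Cs (i<Q , min-i , asc-i) → no-β (min-ascents-configuration BQ minQ Q<n i<Q min-i asc-i
          Cs↑ (All.map (λ ((_ , _ , asc) , c<i) → asc , c<i) Cs-ok) length-Cs)

      MinDescent : ℕ → Set
      MinDescent r = LRMin r × suc r < n × g (suc r) < g r

      MinDescent-Gap : ∀ {r} → MinDescent r → Gap r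
      MinDescent-Gap (_ , sr<n , desc) = descent-Gap sr<n desc

      MinDescent-¬LRMin : ∀ {r} → MinDescent r → ¬ LRMin (predecessor r)
      MinDescent-¬LRMin d = proj₂ (LRMin-Gap (proj₁ d) (MinDescent-Gap d))

      min-descents-configuration : ∀ {P i Rs} → Blown P → P ≤ i → MinDescent i →
                                   AllPairs _<_ Rs → All (λ r → MinDescent r × i < r) Rs → length Rs ≡ q →
                                   βConfiguration
      min-descents-configuration {P} {i} {Rs} BP P≤i d-i Rs↑ Rs-ok length-Rs = record
        { x = suc i ; y = predecessor i ; x<y = proj₁ (LRMin-Gap (proj₁ d-i) Gi) ; y<n = Gap.t<n Gi
        ; gx<gy = Gap.gap Gi
        ; left = blown P BP (s≤s P≤i , <-≤-trans (≤-reflexive (Gap.g-t Gi)) (LRMin-≤ (proj₁ d-i) P≤i))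
        ; right = entries (map predecessor Rs) (AllPairs-map predecessor descending Rs-ok Rs↑)
                          (All.map⁺ (All.map region Rs-ok)) (trans (length-map predecessor Rs) length-Rs) }
        where
        Gi = MinDescent-Gap d-i
        ordered : ∀ {a b} → MinDescent a → MinDescent b → g b < g a →
                  predecessor a < predecessor b × g (predecessor b) < g (predecessor a)
        ordered d-a d-b gb<ga = larger-earlier (MinDescent-¬LRMin d-b) (Gap.t<n Ga) (Gap.t<n Gb) gtb<gta , gtb<gta
          where
          Ga = MinDescent-Gap d-a
          Gb = MinDescent-Gap d-b
          gtb<gta = predecessor-mono (Gap.g-t Ga) (Gap.g-t Gb) gb<ga
        descending : ∀ {a b} → MinDescent a × i < a → MinDescent b × i < b → a < b →
                     predecessor a < predecessor b × g (predecessor b) < g (predecessor a)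
        descending (d-a , _) (d-b , _) a<b = ordered d-a d-b (proj₁ d-b a<b)
        region : ∀ {r} → MinDescent r × i < r →
                 predecessor i < predecessor r × predecessor r < n × g (predecessor r) < g (suc i)
        region (d-r , i<r) =
          proj₁ (ordered d-i d-r (proj₁ d-r i<r)) , Gap.t<n Gr ,
          <-≤-trans (≤-reflexive (Gap.g-t Gr)) (LRMin-≤ (proj₁ d-r) i<r)
          where Gr = MinDescent-Gap d-r

      min-descents≤q : ∀ {P Q Ds} → Blown P → Q < n → AllPairs _<_ Ds →
                       All (λ j → P ≤ j × j < Q × LRMin j × ¬ Ascent j) Ds → length Ds ≤ q
      min-descents≤q {Q = Q} BP Q<n Ds↑ Ds-ok = no-one-then-k⇒length≤ q Ds↑ Ds-ok
        λ (P≤i , i<Q , min-i , ¬asc-i) Rs↑ Rs-ok length-Rs → no-β (min-descents-configuration BP P≤i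
          (descent i<Q min-i ¬asc-i) Rs↑
          (All.map (λ ((_ , r<Q , min-r , ¬asc-r) , i<r) → descent r<Q min-r ¬asc-r , i<r) Rs-ok) length-Rs)
        where
        descent : ∀ {j} → j < Q → LRMin j → ¬ Ascent j → MinDescent j
        descent j<Q min ¬asc = min , ≤-<-trans j<Q Q<n , ¬ascent⇒descent (≤-<-trans j<Q Q<n) ¬asc

      NonMinMin : ℕ → ℕ → ℕ → Set
      NonMinMin P Q j = P ≤ j × j < Q × ¬ LRMin j × LRMin (suc j)

      nonmin-min-configuration : ∀ {P Q i Rs} → Blown P → ¬ LRMin P → NonMinMin P Q i →
                                 ¬ LRMin Q → Q < n → AllPairs _<_ Rs →
                                 All (λ r → NonMinMin P Q r × i < r) Rs → length Rs ≡ q → βConfiguration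
      nonmin-min-configuration {P} {Q} {i} {Rs} BP ¬minP (P≤i , i<Q , _ , min-si) ¬minQ Q<n Rs↑ Rs-ok length-Rs
        with first-¬LRMin-after i<Q ¬minQ
      ... | suc x , i<sx , sx≤Q , ¬min-sx , between = record
        { x = x ; y = suc x ; x<y = ≤-refl ; y<n = sx<n ; gx<gy = gx<gsx
        ; left = blown P BP (≤-<-trans P≤i i<x , later-smaller ¬minP (≤-<-trans P≤i i<sx) sx<n)
        ; right = entries (map suc Rs)
                          (suc-LRMin-Descending Rs↑ (All.map (proj₂ ∘ proj₂ ∘ proj₂ ∘ proj₁) Rs-ok))
                          (All.map⁺ (All.map region Rs-ok)) (trans (length-map suc Rs) length-Rs) }
        where
        sx<n = ≤-<-trans sx≤Q Q<n
        i<x : i < x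
        i<x = ≤∧≢⇒< (s≤s⁻¹ i<sx) (λ i≡x → ¬min-sx (subst (LRMin ∘ suc) i≡x min-si))
        min-x : LRMin x
        min-x = between i<x ≤-refl
        gx<gsx : g x < g (suc x)
        gx<gsx with earlier-smaller sx<n ¬min-sx
        ... | k , k<sx , gk<gsx = ≤-<-trans (LRMin-≤ min-x (s≤s⁻¹ k<sx)) gk<gsx
        region : ∀ {r} → NonMinMin P Q r × i < r → suc x < suc r × suc r < n × g (suc r) < g x
        region {r} ((_ , r<Q , ¬min-r , min-sr) , i<r) = s<s x<r , ≤-<-trans r<Q Q<n , min-sr (m<n⇒m<1+n x<r)
          where
          x<r : x < r
          x<r = ≮⇒≥ (λ r<sx → ¬min-r (between i<r r<sx))

      nonmin-min≤q : ∀ {P Q As} → Blown P → ¬ LRMin P → ¬ LRMin Q → Q < n → AllPairs _<_ As →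
                     All (NonMinMin P Q) As → length As ≤ q
      nonmin-min≤q BP ¬minP ¬minQ Q<n As↑ As-ok = no-one-then-k⇒length≤ q As↑ As-ok
        λ i-ok Rs↑ Rs-ok length-Rs →
          no-β (nonmin-min-configuration BP ¬minP i-ok ¬minQ Q<n Rs↑ Rs-ok length-Rs)

      nonmin-min-configuration₀ : ∀ {P Q Rs} → p ≡ 0 → ¬ LRMin P → P < n → Q < n → AllPairs _<_ Rs →
                                  All (NonMinMin P Q) Rs → length Rs ≡ q → βConfiguration
      nonmin-min-configuration₀ {P} {Q} {Rs} p≡0 ¬minP P<n Q<n Rs↑ Rs-ok length-Rs with earlier-LRMin P<n ¬minP
      ... | m , m<P , min-m , gm<gP = record
        { x = m ; y = P ; x<y = m<P ; y<n = P<n ; gx<gy = gm<gP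
        ; left = entries [] [] [] (sym p≡0)
        ; right = entries (map suc Rs) (suc-LRMin-Descending Rs↑ (All.map (proj₂ ∘ proj₂ ∘ proj₂) Rs-ok))
                          (All.map⁺ (All.map region Rs-ok)) (trans (length-map suc Rs) length-Rs) }
        where
        region : ∀ {r} → NonMinMin P Q r → P < suc r × suc r < n × g (suc r) < g m
        region (P≤r , r<Q , _ , min-sr) =
          s≤s P≤r , ≤-<-trans r<Q Q<n , min-sr (<-≤-trans m<P (m≤n⇒m≤1+n P≤r))

      nonmin-min<q₀ : ∀ {P Q As} → p ≡ 0 → ¬ LRMin P → P < n → Q < n → AllPairs _<_ As →
                      All (NonMinMin P Q) As → length As < q
      nonmin-min<q₀ p≡0 ¬minP P<n Q<n As↑ As-ok = no-k⇒length< q As↑ As-ok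
        λ Rs↑ Rs-ok length-Rs → no-β (nonmin-min-configuration₀ p≡0 ¬minP P<n Q<n Rs↑ Rs-ok length-Rs)

      NonMinPair : ℕ → Set
      NonMinPair c = suc c < n × ¬ LRMin c × ¬ LRMin (suc c)

      NonMinPair-Gap : ∀ {c} → NonMinPair c → Gap c
      NonMinPair-Gap (sc<n , ¬min , _) = descent-Gap sc<n (later-smaller ¬min ≤-refl sc<n)

      NonMinPair-predecessor : ∀ {c} → NonMinPair c → predecessor c < c × LRMin (predecessor c)
      NonMinPair-predecessor np@(sc<n , _ , ¬min-sc) =
        ¬LRMin-Gap ¬min-sc (<-trans ≤-refl sc<n) (NonMinPair-Gap np)

      later-below-predecessor : ∀ {c k} → NonMinPair c → ¬ LRMin k → c < k → k < n →
                                g k < g (predecessor c)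
      later-below-predecessor np@(_ , ¬min-c , _) ¬min-k c<k k<n =
        ≤∧≢⇒< (below-predecessor (Gap.g-t G) (later-smaller ¬min-c c<k k<n))
              (λ gk≡gt → ¬min-k (subst LRMin (sym (g-injective k<n (Gap.t<n G) gk≡gt))
                                             (proj₂ (NonMinPair-predecessor np))))
        where G = NonMinPair-Gap np

      NonMinPair-Descending : ∀ {Cs} → AllPairs _<_ Cs → All NonMinPair Cs → Descending (map predecessor Cs)
      NonMinPair-Descending Cs↑ Cs-ok = AllPairs-map predecessor descending Cs-ok Cs↑
        where
        descending : ∀ {a b} → NonMinPair a → NonMinPair b → a < b →
                     predecessor a < predecessor b × g (predecessor b) < g (predecessor a)
        descending np-a@(_ , ¬min-a , _) np-b@(sb<n , _ , _) a<b =
          smaller-later (proj₂ (NonMinPair-predecessor np-a)) gtb<gta , gtb<gta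
          where
          gtb<gta = predecessor-mono (Gap.g-t (NonMinPair-Gap np-a)) (Gap.g-t (NonMinPair-Gap np-b))
                                     (later-smaller ¬min-a a<b (<-trans ≤-refl sb<n))

      nonmin-pairs-configuration : ∀ {Q i Cs} → Blown Q → i < Q → Q < n → NonMinPair i →
                                   AllPairs _<_ Cs → All (λ c → NonMinPair c × c < i) Cs → length Cs ≡ p →
                                   βConfiguration
      nonmin-pairs-configuration {Q} {i} {Cs} BQ i<Q Q<n np-i@(_ , ¬min-i , ¬min-si) Cs↑ Cs-ok length-Cs = record
        { x = predecessor i ; y = i ; x<y = proj₁ (NonMinPair-predecessor np-i) ; y<n = i<n
        ; gx<gy = ≤-reflexive (Gap.g-t Gi)
        ; left = entries (map predecessor Cs) (NonMinPair-Descending Cs↑ (All.map proj₁ Cs-ok))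
                         (All.map⁺ (All.map region Cs-ok)) (trans (length-map predecessor Cs) length-Cs)
        ; right = blown Q BQ (i<Q , Q<n , ≤-<-trans (later-≤ ¬min-si i<Q Q<n) (Gap.gap Gi)) }
        where
        i<n = <-trans i<Q Q<n
        Gi = NonMinPair-Gap np-i
        region : ∀ {c} → NonMinPair c × c < i → predecessor c < predecessor i × g i < g (predecessor c)
        region (np-c@(_ , ¬min-c , _) , c<i) =
          smaller-later (proj₂ (NonMinPair-predecessor np-c))
            (predecessor-mono (Gap.g-t (NonMinPair-Gap np-c)) (Gap.g-t Gi) (later-smaller ¬min-c c<i i<n)) ,
          later-below-predecessor np-c ¬min-i c<i i<n

      nonmin-pairs≤p : ∀ {Q Bs} → Blown Q → Q < n → AllPairs _<_ Bs →
                       All (λ j → j < Q × NonMinPair j) Bs → length Bs ≤ p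
      nonmin-pairs≤p BQ Q<n Bs↑ Bs-ok = no-k-then-one⇒length≤ p Bs↑ Bs-ok
        λ Cs↑ Cs-ok length-Cs (i<Q , np-i) → no-β (nonmin-pairs-configuration BQ i<Q Q<n np-i
          Cs↑ (All.map (λ ((_ , np-c) , c<i) → np-c , c<i) Cs-ok) length-Cs)

      nonmin-pairs-configuration₀ : ∀ {Q Cs} → q ≡ 0 → ¬ LRMin Q → Q < n → AllPairs _<_ Cs →
                                    All (λ c → c < Q × NonMinPair c) Cs → length Cs ≡ p → βConfiguration
      nonmin-pairs-configuration₀ {Q} {Cs} q≡0 ¬minQ Q<n Cs↑ Cs-ok length-Cs with earlier-LRMin Q<n ¬minQ
      ... | m , m<Q , min-m , gm<gQ = record
        { x = m ; y = Q ; x<y = m<Q ; y<n = Q<n ; gx<gy = gm<gQ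
        ; left = entries (map predecessor Cs) (NonMinPair-Descending Cs↑ (All.map proj₂ Cs-ok))
                         (All.map⁺ (All.map region Cs-ok)) (trans (length-map predecessor Cs) length-Cs)
        ; right = entries [] [] [] (sym q≡0) }
        where
        region : ∀ {c} → c < Q × NonMinPair c → predecessor c < m × g Q < g (predecessor c)
        region (c<Q , np) = smaller-later (proj₂ (NonMinPair-predecessor np)) (<-trans gm<gQ gQ<gt) , gQ<gt
          where gQ<gt = later-below-predecessor np ¬minQ c<Q Q<n

      nonmin-pairs<p₀ : ∀ {Q Bs} → q ≡ 0 → ¬ LRMin Q → Q < n → AllPairs _<_ Bs →
                        All (λ j → j < Q × NonMinPair j) Bs → length Bs < p
      nonmin-pairs<p₀ q≡0 ¬minQ Q<n Bs↑ Bs-ok = no-k⇒length< p Bs↑ Bs-ok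
        λ Cs↑ Cs-ok length-Cs → no-β (nonmin-pairs-configuration₀ q≡0 ¬minQ Q<n Cs↑ Cs-ok length-Cs)

      LRMin-window : ∀ {P Q zs} → Blown P → Blown Q → LRMin Q → Q < n → AllPairs _<_ zs →
                     All (λ j → P ≤ j × j < Q × LRMin j) zs → length zs ≤ p + q
      LRMin-window {P} {Q} {zs} BP BQ minQ Q<n zs↑ zs-ok = begin
        length zs                                                     ≡⟨ length-filter-∁ ascent? zs ⟨
        length (filter ascent? zs) + length (filter (∁? ascent?) zs)  ≤⟨ +-mono-≤ ascents descents ⟩
        p + q                                                         ∎
        where
        open ≤-Reasoning
        ascent : ∀ {j} → (P ≤ j × j < Q × LRMin j) × Ascent j → j < Q × LRMin j × Ascent j
        ascent ((_ , j<Q , min) , asc) = j<Q , min , asc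
        descent : ∀ {j} → (P ≤ j × j < Q × LRMin j) × ¬ Ascent j →
                  P ≤ j × j < Q × LRMin j × ¬ Ascent j
        descent ((P≤j , j<Q , min) , ¬asc) = P≤j , j<Q , min , ¬asc
        ascents = min-ascents≤p BQ minQ Q<n (AllPairs.filter⁺ ascent? zs↑)
                                (All.map ascent (All-filter ascent? zs-ok))
        descents = min-descents≤q BP Q<n (AllPairs.filter⁺ (∁? ascent?) zs↑)
                                  (All.map descent (All-filter (∁? ascent?) zs-ok))

      module ¬LRMin-window {P Q zs} (BP : Blown P) (BQ : Blown Q) (¬minP : ¬ LRMin P) (¬minQ : ¬ LRMin Q)
                           (P<n : P < n) (Q<n : Q < n) (zs↑ : AllPairs _<_ zs)
                           (zs-ok : All (λ j → P ≤ j × j < Q × ¬ LRMin j) zs) where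
        private
          next-min? : Decidable (LRMin ∘ suc)
          next-min? = lrmin? ∘ suc
          to-min = filter next-min? zs
          to-nonmin = filter (∁? next-min?) zs
          split : length to-min + length to-nonmin ≡ length zs
          split = length-filter-∁ next-min? zs
          to-min↑ = AllPairs.filter⁺ next-min? zs↑
          to-min-facts : ∀ {j} → (P ≤ j × j < Q × ¬ LRMin j) × LRMin (suc j) → NonMinMin P Q j
          to-min-facts ((P≤j , j<Q , ¬min) , min-s) = P≤j , j<Q , ¬min , min-s
          to-min-ok = All.map to-min-facts (All-filter next-min? zs-ok)
          to-nonmin↑ = AllPairs.filter⁺ (∁? next-min?) zs↑
          to-nonmin-ok : All (λ j → j < Q × NonMinPair j) to-nonmin
          to-nonmin-ok = All.map (λ ((_ , j<Q , ¬min) , ¬min-s) → j<Q , ≤-<-trans j<Q Q<n , ¬min , ¬min-s)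
                                 (All-filter (∁? next-min?) zs-ok)

        length≤ : length zs ≤ p + q
        length≤ = subst₂ _≤_ split (+-comm q p) (+-mono-≤
          (nonmin-min≤q BP ¬minP ¬minQ Q<n to-min↑ to-min-ok)
          (nonmin-pairs≤p BQ Q<n to-nonmin↑ to-nonmin-ok))

        length< : p ≡ 0 ⊎ q ≡ 0 → length zs < p + q
        length< (inj₁ p≡0) = subst₂ _≤_ (cong suc split) (+-comm q p) (+-mono-≤
          (nonmin-min<q₀ p≡0 ¬minP P<n Q<n to-min↑ to-min-ok)
          (nonmin-pairs≤p BQ Q<n to-nonmin↑ to-nonmin-ok))
        length< (inj₂ q≡0) = subst₂ _≤_ (trans (+-suc _ _) (cong suc split)) (+-comm q p) (+-mono-≤
          (nonmin-min≤q BP ¬minP ¬minQ Q<n to-min↑ to-min-ok)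
          (nonmin-pairs<p₀ q≡0 ¬minQ Q<n to-nonmin↑ to-nonmin-ok))

      blown-bound : ∀ {Ds} → AllPairs _<_ Ds → All (λ k → k < n × Blown k) Ds →
                    length Ds ≤ 2 * (p + q) + 2 ×
                    (1 ≤ p + q → p ≡ 0 ⊎ q ≡ 0 → length Ds ≤ 2 * (p + q) + 1)
      blown-bound {Ds} Ds↑ Ds-ok =
        subst₂ _≤_ split (twice-suc (p + q)) (+-mono-≤ mins-bound (nonmins-bound (p + q) proj₁)) ,
        λ 1≤p+q degenerate → subst₂ _≤_ split (suc-+-twice (p + q))
          (+-mono-≤ mins-bound (subst (length nonmins ≤_) (suc-pred (p + q) {{>-nonZero 1≤p+q}})
            (nonmins-bound (pred (p + q)) λ bounds → pred-mono-≤ (proj₂ bounds degenerate))))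
        where
        twice-suc : ∀ m → suc m + suc m ≡ 2 * m + 2
        twice-suc = solve-∀
        suc-+-twice : ∀ m → suc m + m ≡ 2 * m + 1
        suc-+-twice = solve-∀
        mins = filter lrmin? Ds
        nonmins = filter (∁? lrmin?) Ds
        split : length mins + length nonmins ≡ length Ds
        split = length-filter-∁ lrmin? Ds
        forget : ∀ {K : ℕ → Set} {P Q j} → P ≤ j × j < Q × ((j < n × Blown j) × K j) →
                 P ≤ j × j < Q × K j
        forget (P≤j , j<Q , (_ , Kj)) = P≤j , j<Q , Kj
        mins-bound : length mins ≤ suc (p + q)
        mins-bound = window-bound (p + q)
          (λ { ((_ , BP) , _) ((Q<n , BQ) , minQ) zs↑ zs-ok →
               LRMin-window BP BQ minQ Q<n zs↑ (All.map (forget {K = LRMin}) zs-ok) })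
          (AllPairs.filter⁺ lrmin? Ds↑) (All-filter lrmin? Ds-ok)
        nonmins-bound : ∀ K → (∀ {m} → m ≤ p + q × (p ≡ 0 ⊎ q ≡ 0 → m < p + q) → m ≤ K) →
                        length nonmins ≤ suc K
        nonmins-bound K choose = window-bound K
          (λ { ((P<n , BP) , ¬minP) ((Q<n , BQ) , ¬minQ) zs↑ zs-ok →
               let open ¬LRMin-window BP BQ ¬minP ¬minQ P<n Q<n zs↑ (All.map (forget {K = ¬_ ∘ LRMin}) zs-ok)
               in choose (length≤ , length<) })
          (AllPairs.filter⁺ (∁? lrmin?) Ds↑) (All-filter (∁? lrmin?) Ds-ok)

-- Expansions

module Entries (θ : Perm) where

  n : ℕ
  n = length θ

  θ[_] : ℕ → ℕ
  θ[_] = extend 0 (lookup θ)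

  θ-at : ∀ {k} (k<n : k < n) → θ[ k ] ≡ lookup θ (fromℕ< k<n)
  θ-at = extend-fromℕ< 0 (lookup θ)

  irreducible : Irreducible θ → ∀ {i} → suc i < n → θ[ i ] ≢ suc θ[ suc i ]
  irreducible irr {i} si<n = irr (take i θ) (drop (suc (suc i)) θ) θ[ i ] θ[ suc i ] (split-adjacent θ i si<n)

  module _ (perm : IsPerm θ) where

    θ-value : ∀ {k} → k < n → ∃ λ v → v < n × θ[ k ] ≡ suc v
    θ-value k<n with ∈-map⁻ suc (Any-resp-↭ perm (∈-lookup (fromℕ< k<n)))
    ... | v , v∈ , eq = v , ∈-upTo⁻ v∈ , trans (θ-at k<n) eq

    θ-positive : ∀ {k} → k < n → 0 < θ[ k ]
    θ-positive k<n with θ-value k<n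
    ... | _ , _ , eq = subst (0 <_) (sym eq) z<s

    θ-≤ : ∀ {k} → k < n → θ[ k ] ≤ n
    θ-≤ k<n with θ-value k<n
    ... | _ , v<n , eq = subst (_≤ n) (sym eq) v<n

    θ-onto : ∀ {v} → 0 < v → v ≤ n → ∃ λ t → t < n × θ[ t ] ≡ v
    θ-onto {suc u} _ v≤n = toℕ (Any.index v∈θ) , toℕ<n _ ,
                           trans (extend-toℕ 0 (lookup θ) _) (sym (lookup-index v∈θ))
      where
      v∈θ : suc u ∈ θ
      v∈θ = Any-resp-↭ (↭-sym perm) (∈-map⁺ suc (∈-upTo⁺ v≤n))

    θ-injective : ∀ {i j} → i < n → j < n → θ[ i ] ≡ θ[ j ] → i ≡ j
    θ-injective i<n j<n θi≡θj = fromℕ<-injective _ _ i<n j<n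
      (lookup-injective θ-unique (trans (sym (θ-at i<n)) (trans θi≡θj (θ-at j<n))))
      where
      θ-unique : Unique θ
      θ-unique = Unique-resp-↭ (↭⇒↭ₛ (↭-sym perm)) (Unique.map⁺ suc-injective (Unique.upTo⁺ n))

module Expansion (θ : Perm) (E : Subset (length θ)) (N : ℕ) (N>0 : 0 < N) where

  open Entries θ

  mult-positive : ∀ i → 0 < mult θ E N i
  mult-positive i with Vec.lookup E i
  ... | true = N>0
  ... | false = z<s

  block-length : ∀ i → length (block θ E N i) ≡ mult θ E N i
  block-length i = trans (length-map (λ k → below θ E N i + (mult θ E N i ∸ k)) (upTo (mult θ E N i)))
                         (length-upTo (mult θ E N i))

  block-descending : ∀ i → AllPairs _>_ (block θ E N i)
  block-descending i = subst (AllPairs _>_) (sym (map-upTo _ (mult θ E N i)))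
    (AllPairs.applyUpTo⁺₁ _ (mult θ E N i) λ j<k k<m →
      +-monoʳ-< (below θ E N i) (∸-monoʳ-< j<k (<⇒≤ k<m)))

  block-range : ∀ i → All (λ v → below θ E N i < v × v ≤ below θ E N i + mult θ E N i) (block θ E N i)
  block-range i = subst (All _) (sym (map-upTo _ (mult θ E N i)))
    (All.applyUpTo⁺₁ _ (mult θ E N i) λ {t} t<m → m<m+n (below θ E N i) (m<n⇒0<n∸m t<m) ,
                                                  +-monoʳ-≤ (below θ E N i) (m∸n≤m (mult θ E N i) t))

  block-nonempty : ∀ i → ∃ (_∈ block θ E N i)
  block-nonempty i = _ , ∈-map⁺ (λ k → below θ E N i + (mult θ E N i ∸ k)) (∈-upTo⁺ (mult-positive i))

  below-mono : ∀ {i j} → lookup θ i < lookup θ j → below θ E N i + mult θ E N i ≤ below θ E N j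
  below-mono {i} {j} θi<θj = subst (_≤ below θ E N j) (+-comm (mult θ E N i) _)
    (sum-map-+-≤ (mult θ E N i) counted≤ (∈-allFin i) counted-i)
    where
    counted : Fin n → Fin n → ℕ
    counted i k = if does (lookup θ k <? lookup θ i) then mult θ E N k else 0
    if-≤ : ∀ {P Q : Set} (P? : Dec P) (Q? : Dec Q) {a} → (P → Q) →
           (if does P? then a else 0) ≤ (if does Q? then a else 0)
    if-≤ (yes _) (yes _) _ = ≤-refl
    if-≤ (yes P) (no ¬Q) P→Q = contradiction (P→Q P) ¬Q
    if-≤ (no _) _ _ = z≤n
    if-+-≤ : ∀ {P Q : Set} (P? : Dec P) (Q? : Dec Q) {a} → ¬ P → Q →
             a + (if does P? then a else 0) ≤ (if does Q? then a else 0)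
    if-+-≤ (yes P) _ ¬P _ = contradiction P ¬P
    if-+-≤ (no _) (yes _) _ _ = ≤-reflexive (+-identityʳ _)
    if-+-≤ (no _) (no ¬Q) _ Q = contradiction Q ¬Q
    counted≤ : ∀ k → counted i k ≤ counted j k
    counted≤ k = if-≤ (lookup θ k <? lookup θ i) (lookup θ k <? lookup θ j)
                      (λ θk<θi → <-trans θk<θi θi<θj)
    counted-i : mult θ E N i + counted i i ≤ counted j i
    counted-i = if-+-≤ (lookup θ i <? lookup θ i) (lookup θ i <? lookup θ j) (<-irrefl refl) θi<θj

  blocks-ordered : ∀ {i j} → lookup θ i < lookup θ j →
                   All (λ v → All (v <_) (block θ E N j)) (block θ E N i)
  blocks-ordered θi<θj = All.map (λ (_ , v≤) →
      All.map (λ (below< , _) → ≤-<-trans (≤-trans v≤ (below-mono θi<θj)) below<) (block-range _))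
    (block-range _)

  block[_] : ℕ → List ℕ
  block[_] = extend [] (block θ E N)

  blown[_] : ℕ → Bool
  blown[_] = extend false (Vec.lookup E)

  expand-blocks : expand θ E N ≡ concat (map block[_] (upTo n))
  expand-blocks = cong concat (trans (map-tabulate id (block θ E N)) (sym (map-extend-upTo [] (block θ E N))))

  selection⊆expand : ∀ {ks xss} → AllPairs _<_ ks → All (_< n) ks →
                     Pointwise (λ xs k → xs ⊆ block[ k ]) xss ks → concat xss ⊆ expand θ E N
  selection⊆expand ks↑ ks<n picks = subst (_ ⊆_) (sym expand-blocks)
    (concat-⊆ (Sublist.trans (λ { xs⊆ refl → xs⊆ }) (Sublist.fromPointwise picks) (sorted⊆upTo ks↑ ks<n)))

  module _ {k} (k<n : k < n) where

    block-at : block[ k ] ≡ block θ E N (fromℕ< k<n)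
    block-at = extend-fromℕ< [] (block θ E N) k<n

    block[]-descending : AllPairs _>_ block[ k ]
    block[]-descending = subst (AllPairs _>_) (sym block-at) (block-descending _)

    block[]-nonempty : ∃ (_∈ block[ k ])
    block[]-nonempty = subst (λ xs → ∃ (_∈ xs)) (sym block-at) (block-nonempty _)

    block[]-length-positive : 0 < length block[ k ]
    block[]-length-positive = subst (0 <_) (sym (trans (cong length block-at) (block-length _))) (mult-positive _)

    block[]-length : length block[ k ] ≡ (if blown[ k ] then N else 1)
    block[]-length = trans (cong length block-at) (trans (block-length _)
                       (cong (if_then N else 1) (sym (extend-fromℕ< false (Vec.lookup E) k<n))))

  blocks[]-ordered : ∀ {k k′} → k < n → k′ < n → θ[ k ] < θ[ k′ ] →
                     All (λ v → All (v <_) block[ k′ ]) block[ k ]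
  blocks[]-ordered k<n k′<n θk<θk′ rewrite block-at k<n | block-at k′<n =
    blocks-ordered (subst₂ _<_ (θ-at k<n) (θ-at k′<n) θk<θk′)

  no-123 : Avoids (expand θ E N) p123 →
           ∀ {i j k} → i < j → j < k → k < n → θ[ i ] < θ[ j ] → θ[ j ] < θ[ k ] → ⊥
  no-123 avoids {i} {j} {k} i<j j<k k<n θi<θj θj<θk = avoids (a ∷ b ∷ c ∷ [] ,
    selection⊆expand ((i<j ∷ <-trans i<j j<k ∷ []) ∷ (j<k ∷ []) ∷ [] ∷ []) (i<n ∷ j<n ∷ k<n ∷ [])
                     (fromAny a∈ ∷ fromAny b∈ ∷ fromAny c∈ ∷ []) ,
    ascending⇒OrderIso-123 (All.lookup (All.lookup (blocks[]-ordered i<n j<n θi<θj) a∈) b∈)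
                           (All.lookup (All.lookup (blocks[]-ordered j<n k<n θj<θk) b∈) c∈))
    where
    j<n = <-trans j<k k<n
    i<n = <-trans i<j j<n
    a = proj₁ (block[]-nonempty i<n)
    a∈ = proj₂ (block[]-nonempty i<n)
    b = proj₁ (block[]-nonempty j<n)
    b∈ = proj₂ (block[]-nonempty j<n)
    c = proj₁ (block[]-nonempty k<n)
    c∈ = proj₂ (block[]-nonempty k<n)

  module _ (p q : ℕ) where
    open Configurations n θ[_] (λ k → blown[ k ] ≡ true) p q

    positions : ∀ {w R} → Side w R → List ℕ
    positions (entries C _ _ _) = C
    positions (blown d _ _) = d ∷ []

    width : ∀ {w R} → Side w R → ℕ
    width (entries _ _ _ _) = 1
    width {w} (blown _ _ _) = w

    selection : ∀ {w R} → Side w R → List (List ℕ)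
    selection s = map (λ k → take (width s) block[ k ]) (positions s)

    terms : ∀ {w R} → Side w R → List ℕ
    terms s = concat (selection s)

    positions-descending : ∀ {w R} (s : Side w R) → Descending (positions s)
    positions-descending (entries _ C↓ _ _) = C↓
    positions-descending (blown _ _ _) = [] ∷ []

    positions-region : ∀ {w R} (s : Side w R) → All R (positions s)
    positions-region (entries _ _ RC _) = RC
    positions-region (blown _ _ Rd) = Rd ∷ []

    selection-picks : ∀ {w R} (s : Side w R) →
                      Pointwise (λ xs k → xs ⊆ block[ k ]) (selection s) (positions s)
    selection-picks s = picks (positions s)
      where
      picks : ∀ ks → Pointwise (λ xs k → xs ⊆ block[ k ]) (map (λ k → take (width s) block[ k ]) ks) ks
      picks [] = []
      picks (k ∷ ks) = Sublist.take-Sublist (width s) ⊆-refl ∷ picks ks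

    module _ {w : ℕ} {R : ℕ → Set} (inside : ∀ {k} → R k → k < n) where

      terms-length : (s : Side w R) → w ≤ N → length (terms s) ≡ w
      terms-length (entries C _ RC length-C) _ =
        trans (length-concat-take 1 block[_] (All.map (block[]-length-positive ∘ inside) RC))
              (trans (*-identityˡ _) length-C)
      terms-length (blown d Bd Rd) w≤N =
        trans (length-concat-take w block[_]
                (subst (w ≤_) (sym (trans (block[]-length (inside Rd)) (cong (if_then N else 1) Bd))) w≤N ∷ []))
              (*-identityʳ w)

      terms-All : ∀ {P : ℕ → Set} (s : Side w R) → (∀ {k} → R k → All P block[ k ]) → All P (terms s)
      terms-All s P-blocks =
        All.concat⁺ (All.map⁺ (All.map (All.take⁺ (width s) ∘ P-blocks) (positions-region s)))

      terms-descending : (s : Side w R) → AllPairs _>_ (terms s)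
      terms-descending s = AllPairs.concat⁺
        (All.map⁺ (All.map (AllPairs.take⁺ (width s) ∘ block[]-descending ∘ inside) (positions-region s)))
        (AllPairs-map (λ k → take (width s) block[ k ])
          (λ Ra Rb (_ , θb<θa) → All.take⁺ (width s) (All.map (All.take⁺ (width s))
                                   (All.All-swap (blocks[]-ordered (inside Rb) (inside Ra) θb<θa))))
          (positions-region s) (positions-descending s))

    no-β : p ≤ N → q ≤ N → Avoids (expand θ E N) (β p q) → ¬ βConfiguration
    no-β p≤N q≤N avoids config = avoids (terms left ++ a ∷ b ∷ terms right ,
      subst (_⊆ expand θ E N) (sym (concat-++ (selection left) ((a ∷ []) ∷ (b ∷ []) ∷ selection right)))
        (selection⊆expand sorted bounded
          (Pointwise.++⁺ (selection-picks left) (fromAny a∈ ∷ fromAny b∈ ∷ selection-picks right))) ,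
      βShaped⇒OrderIso shape (terms-length left-inside left p≤N) (terms-length right-inside right q≤N))
      where
      open βConfiguration config
      x<n = <-trans x<y y<n
      a = proj₁ (block[]-nonempty x<n)
      a∈ = proj₂ (block[]-nonempty x<n)
      b = proj₁ (block[]-nonempty y<n)
      b∈ = proj₂ (block[]-nonempty y<n)
      left-inside : ∀ {c} → c < x × θ[ y ] < θ[ c ] → c < n
      left-inside (c<x , _) = <-trans c<x x<n
      right-inside : ∀ {e} → y < e × e < n × θ[ e ] < θ[ x ] → e < n
      right-inside (_ , e<n , _) = e<n
      L = positions-region left
      R = positions-region right
      sorted : AllPairs _<_ (positions left ++ x ∷ y ∷ positions right)
      sorted = AllPairs.++⁺ (AllPairs.map proj₁ (positions-descending left))
        ((x<y ∷ All.map (λ (y<e , _) → <-trans x<y y<e) R) ∷ All.map proj₁ R ∷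
         AllPairs.map proj₁ (positions-descending right))
        (All.map (λ (c<x , _) → c<x ∷ <-trans c<x x<y ∷
                                All.map (λ (y<e , _) → <-trans (<-trans c<x x<y) y<e) R) L)
      bounded : All (_< n) (positions left ++ x ∷ y ∷ positions right)
      bounded = All.++⁺ (All.map left-inside L) (x<n ∷ y<n ∷ All.map right-inside R)
      shape : βShaped (terms left) a b (terms right)
      shape = βshaped (terms-descending left-inside left)
        (terms-All left-inside left λ (c<x , θy<θc) →
          All.lookup (blocks[]-ordered y<n (<-trans c<x x<n) θy<θc) b∈)
        (All.lookup (All.lookup (blocks[]-ordered x<n y<n gx<gy) a∈) b∈)
        (terms-All right-inside right λ (_ , e<n , θe<θx) →
          All.map (λ v<block → All.lookup v<block a∈) (blocks[]-ordered e<n x<n θe<θx))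
        (terms-descending right-inside right)

lemma4p7 : (p q : ℕ) → 1 ≤ p + q → (γ : Perm) → InAv p q γ → Irreducible γ →
    (δ : Subset (length γ)) → Expansible p q γ δ →
    (p > 0 → q > 0 → ∣ δ ∣ ≤ 2 * (p + q) + 2) × ((p ≡ 0 ⊎ q ≡ 0) → ∣ δ ∣ ≤ 2 * (p + q) + 1)
lemma4p7 p q 1≤p+q γ (γ-perm , _ , _) γ-irreducible δ expansible =
  (λ _ _ → subst (_≤ 2 * (p + q) + 2) (length-members δ) (proj₁ bounds)) ,
  (λ degenerate → subst (_≤ 2 * (p + q) + 1) (length-members δ) (proj₂ bounds 1≤p+q degenerate))
  where
  N = suc (p + q)
  open Entries γ
  open Expansion γ δ N z<s
  expansion-avoids = proj₂ (expansible N (s≤s z≤n))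
  open Avoids123 n θ[_] (θ-injective γ-perm) (no-123 (proj₁ expansion-avoids))
  open Irreducible (θ-positive γ-perm) (θ-≤ γ-perm) (θ-onto γ-perm) (irreducible γ-irreducible)
  open Bounds (λ k → blown[ k ] ≡ true) p q
    (no-β p q (≤-trans (m≤m+n p q) (n≤1+n _)) (≤-trans (m≤n+m q p) (n≤1+n _)) (proj₂ expansion-avoids))
  bounds = blown-bound (members-sorted δ) (members-inside δ)
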